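{- Let $P,Q$ be second-order polynomials, $q\in\mathrm{mon}$, $k\in\mathbb{N}$, and let $r$ be a first-order polynomial with $\deg r\ge 2$. If there are $p\in\mathrm{mon}$ and $n\in\mathbb{N}$ with $P(p)(n)>Q(p\times q)((n+1)^k)$, then there is $p'\in\mathrm{mon}$ such that $r\big((\mathtt{L}(P))(p')(n)\big)>(\mathtt{L}(\mathtt{L}(Q)))(p'\times q)((n+1)^k)$.
   Context: $\mathrm{mon}$ denotes the set of strictly monotone functions $\mathbb{N}\to\mathbb{N}$; $p\times q$ denotes pointwise product. Second-order polynomials in a type-1 variable $\mathtt{L}$ and type-0 variable $\mathtt{n}$ are built from positive integers and $\mathtt{n}$ by $+$, $\cdot$ and $\mathtt{L}(\cdot)$; $P(p)(k)$ is the value with $\mathtt{L}:=p\in\mathrm{mon}$, $\mathtt{n}:=k$; so $(\mathtt{L}(P))(p)(k)=p(P(p)(k))$. -}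

module Defs where

open import Data.Nat using (ℕ; zero; suc; _+_; _*_; _<_; _⊔_)

StrictMono : (ℕ → ℕ) → Set
StrictMono f = ∀ {m n} → m < n → f m < f n

record Mon : Set where
  constructor mon
  field
    fun  : ℕ → ℕ
    mono : StrictMono fun
open Mon public

_⊗_ : (ℕ → ℕ) → (ℕ → ℕ) → ℕ → ℕ
(p ⊗ q) k = p k * q k

-- second-order polynomials in L (type 1) and n (type 0);
-- constants are positive integers, written  cst c  meaning  suc c
data SPoly : Set where
  cst  : ℕ → SPoly
  var  : SPoly
  _⊕_  : SPoly → SPoly → SPoly
  _⊙_  : SPoly → SPoly → SPoly
  L    : SPoly → SPoly

⟦_⟧ : SPoly → (ℕ → ℕ) → ℕ → ℕ
⟦ cst c ⟧ p k = suc c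
⟦ var ⟧ p k = k
⟦ P ⊕ Q ⟧ p k = ⟦ P ⟧ p k + ⟦ Q ⟧ p k
⟦ P ⊙ Q ⟧ p k = ⟦ P ⟧ p k * ⟦ Q ⟧ p k
⟦ L P ⟧ p k = p (⟦ P ⟧ p k)

data FPoly : Set where
  cst  : ℕ → FPoly        -- cst c denotes the positive integer suc c
  var  : FPoly
  _⊕_  : FPoly → FPoly → FPoly
  _⊙_  : FPoly → FPoly → FPoly

evalF : FPoly → ℕ → ℕ
evalF (cst c) k = suc c
evalF var k = k
evalF (r ⊕ s) k = evalF r k + evalF s k
evalF (r ⊙ s) k = evalF r k * evalF s k

-- degree (exact, since all coefficients are positive)
deg : FPoly → ℕ
deg (cst c) = 0
deg var = 1
deg (r ⊕ s) = deg r ⊔ deg s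
deg (r ⊙ s) = deg r + deg s

-- Raise p by a large constant M at all arguments above A = Q(p×q)((n+1)^k). Every argument
-- at which Q(p×q)((n+1)^k) queries p×q is at most A, so Q is unaffected, and L(L(Q)) can
-- only grow to about (p(C) + M)·q(C) with C = (p×q)(A), which is linear in M. On the other
-- side P only grows, so P(p′)(n) > A and hence L(P)(p′)(n) ≥ M; as deg r ≥ 2, r of it is at
-- least M², which wins once M exceeds p(C) + q(C).
module Submission where

open import Defs
open import Data.Empty using (⊥-elim)
open import Data.Nat
  using (ℕ; zero; suc; _+_; _*_; _^_; _<_; _≤_; _≤?_; z≤n; s≤s; >-nonZero)
open import Data.Nat.Properties
open import Data.Nat.Solver using (module +-*-Solver)
open import Data.Product using (Σ; _,_)
open import Data.Sum using (inj₁; inj₂)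
open import Relation.Binary.PropositionalEquality
open import Relation.Nullary using (yes; no)

Inflationary : (ℕ → ℕ) → Set
Inflationary f = ∀ m → m ≤ f m

Mon-mono-≤ : (p : Mon) → ∀ {m n} → m ≤ n → fun p m ≤ fun p n
Mon-mono-≤ p m≤n with m≤n⇒m<n∨m≡n m≤n
... | inj₁ m<n  = <⇒≤ (mono p m<n)
... | inj₂ refl = ≤-refl

Mon-inflationary : (p : Mon) → Inflationary (fun p)
Mon-inflationary p zero    = z≤n
Mon-inflationary p (suc m) = ≤-<-trans (Mon-inflationary p m) (mono p (n<1+n m))

⊗-inflationary : (p q : Mon) → Inflationary (fun p ⊗ fun q)
⊗-inflationary p q zero    = z≤n
⊗-inflationary p q (suc m) =
  ≤-trans (Mon-inflationary p (suc m))
          (m≤m*n _ _ {{>-nonZero (≤-<-trans z≤n (mono q (n<1+n m)))}})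

⟦⟧-positive : ∀ {f} → Inflationary f → ∀ {x} → 0 < x → ∀ R → 0 < ⟦ R ⟧ f x
⟦⟧-positive infl x>0 (cst c) = s≤s z≤n
⟦⟧-positive infl x>0 var     = x>0
⟦⟧-positive infl x>0 (R ⊕ S) = ≤-trans (⟦⟧-positive infl x>0 R) (m≤m+n _ _)
⟦⟧-positive infl x>0 (R ⊙ S) = *-mono-≤ (⟦⟧-positive infl x>0 R) (⟦⟧-positive infl x>0 S)
⟦⟧-positive infl x>0 (L R)   = ≤-trans (⟦⟧-positive infl x>0 R) (infl _)

-- On a positive argument each subterm of R evaluates to at most the value of R, so every
-- argument at which R queries an inflationary f is bounded by the value of R.
⟦⟧-cong-below : ∀ {f g} → Inflationary f → ∀ {x} → 0 < x → ∀ R →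
  (∀ m → m ≤ ⟦ R ⟧ f x → f m ≡ g m) → ⟦ R ⟧ f x ≡ ⟦ R ⟧ g x
⟦⟧-cong-below infl x>0 (cst c) agree = refl
⟦⟧-cong-below infl x>0 var     agree = refl
⟦⟧-cong-below infl x>0 (R ⊕ S) agree = cong₂ _+_
  (⟦⟧-cong-below infl x>0 R λ m m≤ → agree m (≤-trans m≤ (m≤m+n _ _)))
  (⟦⟧-cong-below infl x>0 S λ m m≤ → agree m (≤-trans m≤ (m≤n+m _ _)))
⟦⟧-cong-below infl x>0 (R ⊙ S) agree = cong₂ _*_
  (⟦⟧-cong-below infl x>0 R λ m m≤ → agree m (≤-trans m≤
     (m≤m*n _ _ {{>-nonZero (⟦⟧-positive infl x>0 S)}})))
  (⟦⟧-cong-below infl x>0 S λ m m≤ → agree m (≤-trans m≤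
     (m≤n*m _ _ {{>-nonZero (⟦⟧-positive infl x>0 R)}})))
⟦⟧-cong-below {f} {g} infl {x} x>0 (L R) agree = begin
  f (⟦ R ⟧ f x) ≡⟨ agree _ (infl _) ⟩
  g (⟦ R ⟧ f x) ≡⟨ cong g (⟦⟧-cong-below infl x>0 R λ m m≤ → agree m (≤-trans m≤ (infl _))) ⟩
  g (⟦ R ⟧ g x) ∎
  where open ≡-Reasoning

⟦⟧-mono-fun : (p : Mon) (f : ℕ → ℕ) → (∀ m → fun p m ≤ f m) →
  ∀ R x → ⟦ R ⟧ (fun p) x ≤ ⟦ R ⟧ f x
⟦⟧-mono-fun p f p≤f (cst c) x = ≤-refl
⟦⟧-mono-fun p f p≤f var     x = ≤-refl
⟦⟧-mono-fun p f p≤f (R ⊕ S) x = +-mono-≤ (⟦⟧-mono-fun p f p≤f R x) (⟦⟧-mono-fun p f p≤f S x)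
⟦⟧-mono-fun p f p≤f (R ⊙ S) x = *-mono-≤ (⟦⟧-mono-fun p f p≤f R x) (⟦⟧-mono-fun p f p≤f S x)
⟦⟧-mono-fun p f p≤f (L R)   x =
  ≤-trans (Mon-mono-≤ p (⟦⟧-mono-fun p f p≤f R x)) (p≤f _)

^deg≤evalF : ∀ {x} → 0 < x → ∀ r → x ^ deg r ≤ evalF r x
^deg≤evalF x>0 (cst c) = s≤s z≤n
^deg≤evalF {x} x>0 var = ≤-reflexive (*-identityʳ x)
^deg≤evalF x>0 (r ⊕ s) with ⊔-sel (deg r) (deg s)
... | inj₁ eq rewrite eq = ≤-trans (^deg≤evalF x>0 r) (m≤m+n _ _)
... | inj₂ eq rewrite eq = ≤-trans (^deg≤evalF x>0 s) (m≤n+m _ _)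
^deg≤evalF {x} x>0 (r ⊙ s) rewrite ^-distribˡ-+-* x (deg r) (deg s) =
  *-mono-≤ (^deg≤evalF x>0 r) (^deg≤evalF x>0 s)

square≤evalF : ∀ {x} → 0 < x → ∀ r → 2 ≤ deg r → x * x ≤ evalF r x
square≤evalF {x} x>0 r 2≤deg = begin
  x * x     ≡⟨ cong (x *_) (sym (*-identityʳ x)) ⟩
  x ^ 2     ≤⟨ ^-monoʳ-≤ x {{>-nonZero x>0}} 2≤deg ⟩
  x ^ deg r ≤⟨ ^deg≤evalF x>0 r ⟩
  evalF r x ∎
  where open ≤-Reasoning

raise : (ℕ → ℕ) → ℕ → ℕ → ℕ → ℕ
raise f A M m with m ≤? A
... | yes _ = f m
... | no  _ = f m + M

raise-below : ∀ f {A} M {m} → m ≤ A → raise f A M m ≡ f m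
raise-below f {A} M {m} m≤A with m ≤? A
... | yes _   = refl
... | no  m≰A = ⊥-elim (m≰A m≤A)

raise-above : ∀ f {A} M {m} → A < m → raise f A M m ≡ f m + M
raise-above f {A} M {m} A<m with m ≤? A
... | yes m≤A = ⊥-elim (<⇒≱ A<m m≤A)
... | no  _   = refl

≤-raise : ∀ f A M m → f m ≤ raise f A M m
≤-raise f A M m with m ≤? A
... | yes _ = ≤-refl
... | no  _ = m≤m+n _ _

raise-≤ : ∀ f A M m → raise f A M m ≤ f m + M
raise-≤ f A M m with m ≤? A
... | yes _ = m≤m+n _ _
... | no  _ = ≤-refl

raise-strictMono : ∀ {f} A M → StrictMono f → StrictMono (raise f A M)
raise-strictMono {f} A M f-mono {m} {n} m<n with m ≤? A | n ≤? A
... | yes _   | yes _   = f-mono m<n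
... | yes _   | no  _   = ≤-trans (f-mono m<n) (m≤m+n _ _)
... | no  m≰A | yes n≤A = ⊥-elim (m≰A (≤-trans (<⇒≤ m<n) n≤A))
... | no  _   | no  _   = +-monoˡ-< M (f-mono m<n)

bump : Mon → ℕ → ℕ → Mon
bump p A M = mon (raise (fun p) A M) (raise-strictMono A M (mono p))

[a+m]*b<m*m : ∀ a b → let m = a + b + 1 in (a + m) * b < m * m
[a+m]*b<m*m a b = begin-strict
  (a + m) * b         ≡⟨ *-distribʳ-+ b a m ⟩
  a * b + m * b       <⟨ +-monoˡ-< (m * b) a*b<m*a+m ⟩
  (m * a + m) + m * b ≡⟨ solve 3 (λ m a b → (m :* a :+ m) :+ m :* b := m :* (a :+ b :+ con 1))
                                 refl m a b ⟩
  m * m               ∎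
  where
  open ≤-Reasoning
  open +-*-Solver
  m = a + b + 1
  a*b<m*a+m : a * b < m * a + m
  a*b<m*a+m = begin-strict
    a * b     ≤⟨ *-monoʳ-≤ a (≤-trans (m≤n+m b a) (m≤m+n (a + b) 1)) ⟩
    a * m     ≡⟨ *-comm a m ⟩
    m * a     <⟨ m<m+n (m * a) (m≤n+m 1 (a + b)) ⟩
    m * a + m ∎

lemma11 : (P Q : SPoly) (q : Mon) (k : ℕ) (r : FPoly) → 2 ≤ deg r →
    (p : Mon) (n : ℕ) → ⟦ Q ⟧ (fun p ⊗ fun q) (suc n ^ k) < ⟦ P ⟧ (fun p) n →
    Σ Mon λ p′ →
      ⟦ L (L Q) ⟧ (fun p′ ⊗ fun q) (suc n ^ k) < evalF r (⟦ L P ⟧ (fun p′) n)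
lemma11 P Q q k r 2≤deg p n Q<P = p′ , goal
  where
  N = suc n ^ k
  A = ⟦ Q ⟧ (fun p ⊗ fun q) N
  C = (fun p ⊗ fun q) A
  a = fun p C
  b = fun q C
  M = a + b + 1
  p′ = bump p A M
  g = fun p′ ⊗ fun q
  x = fun p′ (⟦ P ⟧ (fun p′) n)

  Q-unchanged : ⟦ Q ⟧ g N ≡ A
  Q-unchanged = sym (⟦⟧-cong-below (⊗-inflationary p q) (m^n>0 (suc n) k) Q
    λ m m≤A → cong (_* fun q m) (sym (raise-below (fun p) M m≤A)))

  M≤x : M ≤ x
  M≤x = begin
    M                                ≤⟨ m≤n+m M (fun p (⟦ P ⟧ (fun p′) n)) ⟩
    fun p (⟦ P ⟧ (fun p′) n) + M     ≡⟨ raise-above (fun p) M A<P′ ⟨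
    x                                ∎
    where
    open ≤-Reasoning
    A<P′ : A < ⟦ P ⟧ (fun p′) n
    A<P′ = <-≤-trans Q<P (⟦⟧-mono-fun p (fun p′) (≤-raise (fun p) A M) P n)

  goal : g (g (⟦ Q ⟧ g N)) < evalF r x
  goal = begin-strict
    g (g (⟦ Q ⟧ g N)) ≡⟨ cong (λ y → g (g y)) Q-unchanged ⟩
    g (g A)           ≡⟨ cong (λ y → g (y * fun q A)) (raise-below (fun p) M ≤-refl) ⟩
    g C               ≤⟨ *-monoˡ-≤ b (raise-≤ (fun p) A M C) ⟩
    (a + M) * b       <⟨ [a+m]*b<m*m a b ⟩
    M * M             ≤⟨ *-mono-≤ M≤x M≤x ⟩
    x * x             ≤⟨ square≤evalF (≤-trans (m≤n+m 1 (a + b)) M≤x) r 2≤deg ⟩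
    evalF r x         ∎
    where open ≤-Reasoning
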